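{- Let $N\ge1$ be an integer and $\mathbf t=(k_0,\ell_0,\ldots,k_{N-1},\ell_{N-1})\in\overline{\mathbb N}_+^{2N}$. Then, as formal power series in $\alpha,\beta$, \[ \gamma_{\mathbf t}(\alpha,\beta)=\sum_{\boldsymbol\tau\in\{0,1\}^{2N}}(-1)^{|\boldsymbol\tau|_1}\alpha^{\boldsymbol\tau\cdot\mathbf t_{\mathsf e}}\beta^{\boldsymbol\tau\cdot\mathbf t_{\mathsf o}}\sum_{j=0}^{|\boldsymbol\tau|_{10}}\binom{|\boldsymbol\tau|_{10}}{j}(-1)^j\,\mathfrak b_{N-j}(\alpha,\beta), \] where $\mathfrak b_m(\alpha,\beta)=\left(\frac{\alpha\beta}{(1-\alpha)(1-\beta)}\right)^m$.
   Context: Let $\overline{\mathbb N}_+=\{1,2,3,\ldots\}\cup\{\infty\}$. Let $\alpha,\beta$ be formal variables, $A_0=\begin{pmatrix}1&0\\ \alpha&\beta\end{pmatrix}$, $A_1=\begin{pmatrix}\alpha&\beta\\0&1\end{pmatrix}$ over $\mathbb C[[\alpha,\beta]]$, with usual powers for finite exponents and $A_0^\infty=\begin{pmatrix}1&0\\ \frac{\alpha}{1-\beta}&0\end{pmatrix}$, $A_1^\infty=\begin{pmatrix}0&\frac{\beta}{1-\alpha}\\0&1\end{pmatrix}$. $\gamma_{\mathbf t}(\alpha,\beta)$ is the top-left entry of $A_1^{k_0}A_0^{\ell_0}\cdots A_1^{k_{N-1}}A_0^{\ell_{N-1}}$. Put $\mathbf t_{\mathsf e}=(k_0,0,k_1,0,\ldots,k_{N-1},0)$,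 $\mathbf t_{\mathsf o}=(0,\ell_0,0,\ell_1,\ldots,0,\ell_{N-1})$. For $\boldsymbol\tau=(\tau_0,\ldots,\tau_{2N-1})\in\{0,1\}^{2N}$: $|\boldsymbol\tau|_1=\#\{j:\tau_j=1\}$, $|\boldsymbol\tau|_{10}=\#\{0\le j<2N-1:(\tau_j,\tau_{j+1})=(1,0)\}$, $\boldsymbol\tau\cdot\mathbf u=\sum_j\tau_ju_j$ with conventions $0\cdot\infty=0$, $a+\infty=\infty$, $\alpha^\infty=\beta^\infty=0$. -}

module Defs where

open import Data.Nat using (ℕ; zero; suc; _∸_; _≤_) renaming (_+_ to _+ℕ_; _*_ to _*ℕ_)
open import Data.Nat.Combinatorics using (_C_)
open import Data.Integer using (ℤ; +_; 0ℤ; 1ℤ; -1ℤ; _+_; _*_; -_; _^_)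
open import Data.Bool using (Bool; true; false)
open import Data.List using (List; []; _∷_; map; foldr; upTo; zipWith; _++_)
open import Data.Vec using (Vec; toList) renaming ([] to []ᵥ; _∷_ to _∷ᵥ_)
open import Data.Unit using (⊤)

-- Formal power series in two variables α, β with integer coefficients:
-- f i j = coefficient of α^i β^j.  (All series in the statement have
-- integer coefficients; ℤ[[α,β]] ⊂ ℂ[[α,β]].)

PS : Set
PS = ℕ → ℕ → ℤ

Σ< : ℕ → (ℕ → ℤ) → ℤ
Σ< zero    f = 0ℤ
Σ< (suc n) f = Σ< n f + f n

0ₚ : PS
0ₚ _ _ = 0ℤ

constₚ : ℤ → PS
constₚ c zero zero = c
constₚ c _    _    = 0ℤ

1ₚ : PS
1ₚ = constₚ 1ℤ

αₚ : PS
αₚ (suc zero) zero = 1ℤ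
αₚ _ _ = 0ℤ

βₚ : PS
βₚ zero (suc zero) = 1ℤ
βₚ _ _ = 0ℤ

infixl 6 _+ₚ_
infixl 7 _*ₚ_

_+ₚ_ : PS → PS → PS
(f +ₚ g) i j = f i j + g i j

-ₚ_ : PS → PS
(-ₚ f) i j = - f i j

_*ₚ_ : PS → PS → PS
(f *ₚ g) i j = Σ< (suc i) λ a → Σ< (suc j) λ b → f a b * g (i ∸ a) (j ∸ b)

_^ₚ_ : PS → ℕ → PS
f ^ₚ zero  = 1ₚ
f ^ₚ suc n = f *ₚ (f ^ₚ n)

sumₚ : List PS → PS
sumₚ = foldr _+ₚ_ 0ₚ

-- 1/(1-α) = Σ_n α^n  and  1/(1-β) = Σ_n β^n
inv1-α : PS
inv1-α _ zero    = 1ℤ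
inv1-α _ (suc _) = 0ℤ

inv1-β : PS
inv1-β zero    _ = 1ℤ
inv1-β (suc _) _ = 0ℤ

data ℕ∞ : Set where
  fin : ℕ → ℕ∞
  ∞   : ℕ∞

Pos : ℕ∞ → Set
Pos (fin n) = 1 ≤ n
Pos ∞       = ⊤

_+∞_ : ℕ∞ → ℕ∞ → ℕ∞
fin m +∞ fin n = fin (m +ℕ n)
fin _ +∞ ∞     = ∞
∞     +∞ _     = ∞

-- τ_j · u_j with 0 · ∞ = 0
_·∞_ : Bool → ℕ∞ → ℕ∞
false ·∞ _ = fin 0
true  ·∞ u = u

dot : List Bool → List ℕ∞ → ℕ∞
dot τ u = foldr _+∞_ (fin 0) (zipWith _·∞_ τ u)

-- x^u with x^∞ = 0  (used for x = α, β)
_^∞_ : PS → ℕ∞ → PS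
x ^∞ fin n = x ^ₚ n
x ^∞ ∞     = 0ₚ

record M2 : Set where
  constructor mat
  field
    m00 m01 m10 m11 : PS
open M2 public

_*ₘ_ : M2 → M2 → M2
mat a b c d *ₘ mat a' b' c' d' =
  mat (a *ₚ a' +ₚ b *ₚ c') (a *ₚ b' +ₚ b *ₚ d')
      (c *ₚ a' +ₚ d *ₚ c') (c *ₚ b' +ₚ d *ₚ d')

Iₘ : M2
Iₘ = mat 1ₚ 0ₚ 0ₚ 1ₚ

_^ₘ_ : M2 → ℕ → M2
A ^ₘ zero  = Iₘ
A ^ₘ suc n = A *ₘ (A ^ₘ n)

A₀ A₁ A₀∞ A₁∞ : M2
A₀  = mat 1ₚ 0ₚ αₚ βₚ
A₁  = mat αₚ βₚ 0ₚ 1ₚ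
A₀∞ = mat 1ₚ 0ₚ (αₚ *ₚ inv1-β) 0ₚ
A₁∞ = mat 0ₚ (βₚ *ₚ inv1-α) 0ₚ 1ₚ

A₀^ A₁^ : ℕ∞ → M2
A₀^ (fin n) = A₀ ^ₘ n
A₀^ ∞       = A₀∞
A₁^ (fin n) = A₁ ^ₘ n
A₁^ ∞       = A₁∞

prodMat : List ℕ∞ → M2
prodMat []             = Iₘ
prodMat (k ∷ [])       = A₁^ k
prodMat (k ∷ ℓ ∷ rest) = A₁^ k *ₘ (A₀^ ℓ *ₘ prodMat rest)

γ : ∀ {n} → Vec ℕ∞ n → PS
γ t = m00 (prodMat (toList t))

-- t_e keeps even positions (k_i), zeroes odd ones; t_o the opposite
evenPart oddPart : List ℕ∞ → List ℕ∞
evenPart []      = []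
evenPart (x ∷ r) = x ∷ oddPart r
oddPart  []      = []
oddPart  (x ∷ r) = fin 0 ∷ evenPart r

allWords : (n : ℕ) → List (Vec Bool n)
allWords zero    = []ᵥ ∷ []
allWords (suc n) = map (false ∷ᵥ_) (allWords n) ++ map (true ∷ᵥ_) (allWords n)

count1 : List Bool → ℕ
count1 []          = 0
count1 (true ∷ r)  = suc (count1 r)
count1 (false ∷ r) = count1 r

count10 : List Bool → ℕ
count10 []               = 0
count10 (true ∷ false ∷ r) = suc (count10 (false ∷ r))
count10 (_ ∷ r)          = count10 r

𝔟 : ℕ → PS
𝔟 m = (αₚ *ₚ βₚ *ₚ inv1-α *ₚ inv1-β) ^ₚ m

Σ≤ₚ : ℕ → (ℕ → PS) → PS
Σ≤ₚ m f = sumₚ (map f (upTo (suc m)))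

rhs : (N : ℕ) → Vec ℕ∞ (2 *ℕ N) → PS
rhs N t = sumₚ (map term (allWords (2 *ℕ N)))
  where
  term : Vec Bool (2 *ℕ N) → PS
  term τv =
    let τ = toList τv
        u = toList t
        m = count10 τ
    in constₚ (-1ℤ ^ count1 τ) *ₚ (αₚ ^∞ dot τ (evenPart u)) *ₚ (βₚ ^∞ dot τ (oddPart u))
       *ₚ Σ≤ₚ m (λ j → constₚ (+ (m C j) * (-1ℤ ^ j)) *ₚ 𝔟 (N ∸ j))

-- Put 𝔭 = β/(1-α) and 𝔮 = α/(1-β), so that 𝔟₁ = 𝔭𝔮.  Then A₁^k = [[x, 𝔭(1-x)], [0, 1]] and
-- A₀^ℓ = [[1, 0], [𝔮(1-y), y]] with x = α^k, y = β^ℓ (x = 0, resp. y = 0, for an infinite exponent),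
-- so γ_t is a multilinear polynomial in the x_i, y_i.  Up to the sign (-1)^|τ|₁, its coefficient at the
-- monomial selected by a binary word τ is a product of local weights along τ: a pair of letters contributes
-- 𝔟₁ - 1 when it completes a factor 10 and 𝔟₁ otherwise, so it equals 𝔟₁^(N-m) (𝔟₁ - 1)^m with m = |τ|₁₀,
-- which the binomial theorem turns into Σ_j (m choose j) (-1)^j 𝔟_(N-j).  The expansion is proved by
-- induction over the pairs (k_i, ℓ_i): writing G_b for the word sum whose weights start after the
-- letter b, the first column of the matrix product is (G_false, 𝔮 (G_false - G_true)).

module Submission where

open import Algebra using (CommutativeRing)
open import Algebra.Bundles using (RawRing)
import Algebra.Construct.Pointwise as Pointwise
open import Data.Bool using (Bool; true; false)
open import Data.Fin using (toℕ)
open import Data.Fin.Properties using (toℕ≤pred[n])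
open import Data.Nat using (ℕ; zero; suc; _∸_; _≤_; _<_; z≤n; s≤s) renaming (_+_ to _+ℕ_)
open import Data.Nat.Combinatorics using (_C_)
open import Data.Nat.Properties
  using (n∸n≡0; m+[n∸m]≡n; ∸-+-assoc; m∸[m∸n]≡n; +-∸-assoc; m∸n+n≡m; n<1+n; m<n⇒m<1+n; ≤-trans; n≤1+n; *-suc; suc-injective)
open import Data.Product using (_,_)
open import Relation.Binary.PropositionalEquality as ≡ using (_≡_)

module FormalPowerSeries {c ℓ} (R : CommutativeRing c ℓ) where

  open CommutativeRing R
  open import Algebra.Properties.CommutativeSemigroup +-commutativeSemigroup using (x∙yz≈y∙xz)
  open import Relation.Binary.Reasoning.Setoid setoid

  ∑ : ℕ → (ℕ → Carrier) → Carrier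
  ∑ zero    f = 0#
  ∑ (suc n) f = ∑ n f + f n

  ∑-cong-< : ∀ n {f g : ℕ → Carrier} → (∀ a → a < n → f a ≈ g a) → ∑ n f ≈ ∑ n g
  ∑-cong-< zero    f≈g = refl
  ∑-cong-< (suc n) f≈g = +-cong (∑-cong-< n λ a a<n → f≈g a (m<n⇒m<1+n a<n)) (f≈g n (n<1+n n))

  ∑-cong : ∀ n {f g : ℕ → Carrier} → (∀ a → f a ≈ g a) → ∑ n f ≈ ∑ n g
  ∑-cong n f≈g = ∑-cong-< n (λ a _ → f≈g a)

  ∑-distrib-+ : ∀ n (f g : ℕ → Carrier) → ∑ n (λ a → f a + g a) ≈ ∑ n f + ∑ n g
  ∑-distrib-+ zero    f g = sym (+-identityˡ 0#)
  ∑-distrib-+ (suc n) f g = begin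
    ∑ n (λ a → f a + g a) + (f n + g n)  ≈⟨ +-congʳ (∑-distrib-+ n f g) ⟩
    (∑ n f + ∑ n g) + (f n + g n)        ≈⟨ +-assoc _ _ _ ⟩
    ∑ n f + (∑ n g + (f n + g n))        ≈⟨ +-congˡ (x∙yz≈y∙xz _ _ _) ⟩
    ∑ n f + (f n + (∑ n g + g n))        ≈⟨ +-assoc _ _ _ ⟨
    (∑ n f + f n) + (∑ n g + g n)        ∎

  *-distribˡ-∑ : ∀ n x (f : ℕ → Carrier) → x * ∑ n f ≈ ∑ n (λ a → x * f a)
  *-distribˡ-∑ zero    x f = zeroʳ x
  *-distribˡ-∑ (suc n) x f = trans (distribˡ x _ _) (+-congʳ (*-distribˡ-∑ n x f))

  *-distribʳ-∑ : ∀ n x (f : ℕ → Carrier) → ∑ n f * x ≈ ∑ n (λ a → f a * x)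
  *-distribʳ-∑ zero    x f = zeroˡ x
  *-distribʳ-∑ (suc n) x f = trans (distribʳ x _ _) (+-congʳ (*-distribʳ-∑ n x f))

  ∑-zero : ∀ n → ∑ n (λ _ → 0#) ≈ 0#
  ∑-zero zero    = refl
  ∑-zero (suc n) = trans (+-identityʳ _) (∑-zero n)

  ∑-head : ∀ n (f : ℕ → Carrier) → ∑ (suc n) f ≈ f 0 + ∑ n (λ a → f (suc a))
  ∑-head zero    f = trans (+-identityˡ _) (sym (+-identityʳ _))
  ∑-head (suc n) f = trans (+-congʳ (∑-head n f)) (+-assoc _ _ _)

  ∑-reverse : ∀ n (f : ℕ → Carrier) → ∑ (suc n) f ≈ ∑ (suc n) (λ a → f (n ∸ a))
  ∑-reverse zero    f = refl
  ∑-reverse (suc n) f = begin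
    ∑ (suc n) f + f (suc n)                       ≈⟨ +-congʳ (∑-reverse n f) ⟩
    ∑ (suc n) (λ a → f (n ∸ a)) + f (suc n)       ≈⟨ +-comm _ _ ⟩
    f (suc n) + ∑ (suc n) (λ a → f (n ∸ a))       ≈⟨ ∑-head (suc n) (λ a → f (suc n ∸ a)) ⟨
    ∑ (suc (suc n)) (λ a → f (suc n ∸ a))         ∎

  -- Both sides sum F b e over the triangle b + e ≤ n.
  ∑-triangle : ∀ n (F : ℕ → ℕ → Carrier) →
               ∑ (suc n) (λ a → ∑ (suc a) (λ b → F b (a ∸ b))) ≈
               ∑ (suc n) (λ b → ∑ (suc (n ∸ b)) (F b))
  ∑-triangle zero    F = refl
  ∑-triangle (suc n) F = begin
    ∑ (suc n) (λ a → ∑ (suc a) (λ b → F b (a ∸ b))) + ∑ (suc (suc n)) (λ b → F b (suc n ∸ b))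
      ≈⟨ +-congʳ (∑-triangle n F) ⟩
    ∑ (suc n) (λ b → ∑ (suc (n ∸ b)) (F b)) + (∑ (suc n) (λ b → F b (suc n ∸ b)) + F (suc n) (n ∸ n))
      ≈⟨ +-assoc _ _ _ ⟨
    (∑ (suc n) (λ b → ∑ (suc (n ∸ b)) (F b)) + ∑ (suc n) (λ b → F b (suc n ∸ b))) + F (suc n) (n ∸ n)
      ≈⟨ +-cong (∑-distrib-+ (suc n) _ _) (diagonal (F (suc n))) ⟨
    ∑ (suc n) (λ b → ∑ (suc (n ∸ b)) (F b) + F b (suc n ∸ b)) + ∑ (suc (n ∸ n)) (F (suc n))
      ≈⟨ +-congʳ (∑-cong-< (suc n) extend) ⟩
    ∑ (suc n) (λ b → ∑ (suc (suc n ∸ b)) (F b)) + ∑ (suc (n ∸ n)) (F (suc n))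
      ∎
    where
    extend : ∀ b → b < suc n → ∑ (suc (n ∸ b)) (F b) + F b (suc n ∸ b) ≈ ∑ (suc (suc n ∸ b)) (F b)
    extend b (s≤s b≤n) rewrite +-∸-assoc 1 b≤n = refl
    diagonal : ∀ f → ∑ (suc (n ∸ n)) f ≈ f (n ∸ n)
    diagonal f rewrite n∸n≡0 n = +-identityˡ _

  Series : Set c
  Series = ℕ → Carrier

  infix  4 _≋_
  infixl 6 _⊕_
  infixl 7 _⊛_

  _≋_ : Series → Series → Set ℓ
  f ≋ g = ∀ n → f n ≈ g n

  _⊕_ : Series → Series → Series
  (f ⊕ g) n = f n + g n

  ⊖_ : Series → Series
  (⊖ f) n = - f n

  𝟘 : Series
  𝟘 _ = 0#

  const : Carrier → Series
  const c zero    = c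
  const c (suc _) = 0#

  𝟙 : Series
  𝟙 = const 1#

  X : Series
  X zero    = 0#
  X (suc n) = 𝟙 n

  _⊛_ : Series → Series → Series
  (f ⊛ g) n = ∑ (suc n) (λ a → f a * g (n ∸ a))

  ⊛-cong : ∀ {f f′ g g′} → f ≋ f′ → g ≋ g′ → f ⊛ g ≋ f′ ⊛ g′
  ⊛-cong f≋f′ g≋g′ n = ∑-cong (suc n) (λ a → *-cong (f≋f′ a) (g≋g′ (n ∸ a)))

  ⊛-comm : ∀ f g → f ⊛ g ≋ g ⊛ f
  ⊛-comm f g n = trans (∑-reverse n _) (∑-cong-< (suc n) swap)
    where
    swap : ∀ a → a < suc n → f (n ∸ a) * g (n ∸ (n ∸ a)) ≈ g a * f (n ∸ a)
    swap a (s≤s a≤n) rewrite m∸[m∸n]≡n a≤n = *-comm _ _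

  const-⊛ : ∀ c f n → (const c ⊛ f) n ≈ c * f n
  const-⊛ c f n = begin
    ∑ (suc n) (λ a → const c a * f (n ∸ a))    ≈⟨ ∑-head n _ ⟩
    c * f n + ∑ n (λ a → 0# * f (n ∸ suc a))    ≈⟨ +-congˡ (trans (∑-cong n (λ a → zeroˡ _)) (∑-zero n)) ⟩
    c * f n + 0#                                ≈⟨ +-identityʳ _ ⟩
    c * f n                                     ∎

  ⊛-identityˡ : ∀ f → 𝟙 ⊛ f ≋ f
  ⊛-identityˡ f n = trans (const-⊛ 1# f n) (*-identityˡ _)

  X⊛-zero : ∀ f → (X ⊛ f) 0 ≈ 0#
  X⊛-zero f = trans (+-identityˡ _) (zeroˡ _)

  X⊛-suc : ∀ f n → (X ⊛ f) (suc n) ≈ f n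
  X⊛-suc f n = begin
    ∑ (suc (suc n)) (λ a → X a * f (suc n ∸ a))    ≈⟨ ∑-head (suc n) _ ⟩
    0# * f (suc n) + (𝟙 ⊛ f) n                     ≈⟨ +-congʳ (zeroˡ _) ⟩
    0# + (𝟙 ⊛ f) n                                 ≈⟨ +-identityˡ _ ⟩
    (𝟙 ⊛ f) n                                      ≈⟨ ⊛-identityˡ f n ⟩
    f n                                            ∎

  ⊛-distribʳ : ∀ h f g → (f ⊕ g) ⊛ h ≋ f ⊛ h ⊕ g ⊛ h
  ⊛-distribʳ h f g n = trans (∑-cong (suc n) (λ a → distribʳ _ _ _)) (∑-distrib-+ (suc n) _ _)

  ⊛-assoc : ∀ f g h → (f ⊛ g) ⊛ h ≋ f ⊛ (g ⊛ h)
  ⊛-assoc f g h n = begin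
    ∑ (suc n) (λ a → ∑ (suc a) (λ b → f b * g (a ∸ b)) * h (n ∸ a))
      ≈⟨ ∑-cong (suc n) (λ a → *-distribʳ-∑ (suc a) _ _) ⟩
    ∑ (suc n) (λ a → ∑ (suc a) (λ b → f b * g (a ∸ b) * h (n ∸ a)))
      ≈⟨ ∑-cong-< (suc n) (λ a a≤n → ∑-cong-< (suc a) (λ b b≤a → reassociate a b b≤a)) ⟩
    ∑ (suc n) (λ a → ∑ (suc a) (λ b → F b (a ∸ b)))
      ≈⟨ ∑-triangle n F ⟩
    ∑ (suc n) (λ b → ∑ (suc (n ∸ b)) (F b))
      ≈⟨ ∑-cong (suc n) (λ b → *-distribˡ-∑ (suc (n ∸ b)) (f b) _) ⟨
    ∑ (suc n) (λ b → f b * ∑ (suc (n ∸ b)) (λ e → g e * h (n ∸ b ∸ e)))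
      ∎
    where
    F : ℕ → ℕ → Carrier
    F b e = f b * (g e * h (n ∸ b ∸ e))
    reassociate : ∀ a b → b < suc a → f b * g (a ∸ b) * h (n ∸ a) ≈ F b (a ∸ b)
    reassociate a b (s≤s b≤a) rewrite ∸-+-assoc n b (a ∸ b) | m+[n∸m]≡n b≤a = *-assoc _ _ _

  commutativeRing : CommutativeRing c ℓ
  commutativeRing = record { isCommutativeRing = record
    { isRing = record
      { +-isAbelianGroup = Pointwise.isAbelianGroup ℕ +-isAbelianGroup
      ; *-cong           = ⊛-cong
      ; *-assoc          = ⊛-assoc
      ; *-identity       = ⊛-identityˡ , λ f n → trans (⊛-comm f 𝟙 n) (⊛-identityˡ f n)
      ; distrib          = (λ h f g n → trans (⊛-comm h (f ⊕ g) n)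
                                         (trans (⊛-distribʳ h f g n) (+-cong (⊛-comm f h n) (⊛-comm g h n))))
                         , ⊛-distribʳ
      }
    ; *-comm = ⊛-comm
    } }

module AlternatingBinomial {c ℓ} (R : CommutativeRing c ℓ) where

  open CommutativeRing R
  open import Algebra.Properties.CommutativeSemiring.Binomial commutativeSemiring using (theorem)
  open import Algebra.Properties.Semiring.Sum semiring using (sum⁺-syntax; sum-cong-≋; *-distribˡ-sum)
  open import Algebra.Properties.Semiring.Mult semiring using (_×_; ×-comm-*; ×-congʳ)
  open import Algebra.Properties.Semiring.Exp semiring using (_^_; ^-homo-*; ^-congʳ)
  open import Algebra.Properties.CommutativeSemigroup *-commutativeSemigroup using (x∙yz≈y∙xz)
  open import Relation.Binary.Reasoning.Setoid setoid

  ∑-alternating-binomial : ∀ {m N} → m ≤ N → ∀ x →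
    ∑[ j ≤ m ] ((m C toℕ j) × ((- 1#) ^ toℕ j * x ^ (N ∸ toℕ j))) ≈ x ^ (N ∸ m) * (- 1# + x) ^ m
  ∑-alternating-binomial {m} {N} m≤N x = sym (begin
    x ^ (N ∸ m) * (- 1# + x) ^ m
      ≈⟨ *-congˡ (theorem m (- 1#) x) ⟩
    x ^ (N ∸ m) * ∑[ j ≤ m ] ((m C toℕ j) × ((- 1#) ^ toℕ j * x ^ (m ∸ toℕ j)))
      ≈⟨ *-distribˡ-sum {suc m} (x ^ (N ∸ m)) (λ j → (m C toℕ j) × ((- 1#) ^ toℕ j * x ^ (m ∸ toℕ j))) ⟩
    ∑[ j ≤ m ] (x ^ (N ∸ m) * ((m C toℕ j) × ((- 1#) ^ toℕ j * x ^ (m ∸ toℕ j))))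
      ≈⟨ sum-cong-≋ {suc m} (λ j → trans (×-comm-* (m C toℕ j) _ _) (×-congʳ (m C toℕ j) (shift (toℕ≤pred[n] j)))) ⟩
    ∑[ j ≤ m ] ((m C toℕ j) × ((- 1#) ^ toℕ j * x ^ (N ∸ toℕ j)))
      ∎)
    where
    shift : ∀ {j} → j ≤ m → x ^ (N ∸ m) * ((- 1#) ^ j * x ^ (m ∸ j)) ≈ (- 1#) ^ j * x ^ (N ∸ j)
    shift {j} j≤m = begin
      x ^ (N ∸ m) * ((- 1#) ^ j * x ^ (m ∸ j))   ≈⟨ x∙yz≈y∙xz _ _ _ ⟩
      (- 1#) ^ j * (x ^ (N ∸ m) * x ^ (m ∸ j))   ≈⟨ *-congˡ (sym (^-homo-* x (N ∸ m) (m ∸ j))) ⟩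
      (- 1#) ^ j * x ^ ((N ∸ m) +ℕ (m ∸ j))       ≈⟨ *-congˡ (^-congʳ x [N∸m]+[m∸j]≡N∸j) ⟩
      (- 1#) ^ j * x ^ (N ∸ j)                   ∎
      where
      [N∸m]+[m∸j]≡N∸j : (N ∸ m) +ℕ (m ∸ j) ≡ N ∸ j
      [N∸m]+[m∸j]≡N∸j = ≡.trans (≡.sym (+-∸-assoc (N ∸ m) j≤m)) (≡.cong (_∸ j) (m∸n+n≡m m≤N))

-- Written over an arbitrary raw ring so that the same expressions also serve as ring-solver input.
module PairExpansion {a ℓ} (R : RawRing a ℓ) where

  open RawRing R

  sign : Bool → Carrier
  sign false = 1#
  sign true  = - 1#

  pick : Bool → Carrier → Carrier
  pick false _ = 1#
  pick true  x = x

  -- The first two clauses are the pairs (s , t) that, read after the letter b, complete a factor 10.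
  pairWeight : Carrier → Bool → Bool → Bool → Carrier
  pairWeight c true  false _     = - 1# + c
  pairWeight c _     true  false = - 1# + c
  pairWeight c _     _     _     = c

  pairCoefficient : (c x y : Carrier) → Bool → Bool → Bool → Carrier
  pairCoefficient c x y b s t = sign s * pick s x * (sign t * pick t y) * pairWeight c b s t

  pairSum : (c x y G₀ G₁ : Carrier) → Bool → Carrier
  pairSum c x y G₀ G₁ b =
    (pairCoefficient c x y b false false * G₀ + pairCoefficient c x y b false true * G₁) +
    (pairCoefficient c x y b true  false * G₀ + pairCoefficient c x y b true  true * G₁)

open import Defs
open import Algebra.Morphism.Structures using (IsRingMonomorphism)
import Algebra.Morphism.RingMonomorphism as RingMonomorphism
import Algebra.Solver.CommutativeMonoid as CommutativeMonoidSolver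
import Algebra.Solver.Ring.AlmostCommutativeRing as ACR
open import Data.Fin.Patterns using (0F; 1F; 2F; 3F; 4F; 5F; 6F; 7F; 8F)
open import Data.Integer using (+_; 0ℤ; 1ℤ; -1ℤ)
  renaming (_+_ to _+ℤ_; _*_ to _*ℤ_; -_ to -ℤ_; _^_ to _^ℤ_; _≟_ to _≟ℤ_)
import Data.Integer.Properties as ℤ
open import Data.List using (List; []; _∷_; _++_; map; length; applyUpTo)
import Data.List.Properties as List
open import Data.Maybe using (Maybe; just; nothing)
open import Data.Nat using (_*_)
open import Data.Product using (_×_; proj₁; proj₂)
open import Data.Vec using (Vec; toList) renaming ([] to []ᵥ; _∷_ to _∷ᵥ_)
open import Data.Vec.Properties using (length-toList)
open import Data.Vec.Relation.Unary.All using (All)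
open import Function using (id)
open import Relation.Nullary using (yes; no)

data Pairs {A : Set} : ℕ → List A → Set where
  []   : Pairs 0 []
  pair : ∀ {n xs} x y → Pairs n xs → Pairs (suc n) (x ∷ y ∷ xs)

length⇒Pairs : ∀ {A : Set} n (xs : List A) → length xs ≡ 2 * n → Pairs n xs
length⇒Pairs zero    []           _  = []
length⇒Pairs (suc n) (x ∷ y ∷ xs) eq = pair x y (length⇒Pairs n xs (suc-injective (suc-injective (≡.trans eq (*-suc 2 n)))))
length⇒Pairs (suc n) (x ∷ [])     eq with () ← suc-injective (≡.trans eq (*-suc 2 n))

module ℤ[[β]] = FormalPowerSeries ℤ.+-*-commutativeRing
module ℤ[[β]][[α]] = FormalPowerSeries ℤ[[β]].commutativeRing

Σ<≡∑ : ∀ n f → Σ< n f ≡ ℤ[[β]].∑ n f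
Σ<≡∑ zero    f = ≡.refl
Σ<≡∑ (suc n) f = ≡.cong (_+ℤ f n) (Σ<≡∑ n f)

coeff-∑ : ∀ n (F : ℕ → ℤ[[β]].Series) j → ℤ[[β]][[α]].∑ n F j ≡ ℤ[[β]].∑ n (λ a → F a j)
coeff-∑ zero    F j = ≡.refl
coeff-∑ (suc n) F j = ≡.cong (_+ℤ F n j) (coeff-∑ n F j)

*ₚ≋⊛ : ∀ f g → f *ₚ g ℤ[[β]][[α]].≋ f ℤ[[β]][[α]].⊛ g
*ₚ≋⊛ f g i j = begin
  Σ< (suc i) (λ a → Σ< (suc j) (λ b → f a b *ℤ g (i ∸ a) (j ∸ b)))
    ≡⟨ Σ<≡∑ (suc i) _ ⟩
  ℤ[[β]].∑ (suc i) (λ a → Σ< (suc j) (λ b → f a b *ℤ g (i ∸ a) (j ∸ b)))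
    ≡⟨ ℤ[[β]].∑-cong (suc i) (λ a → Σ<≡∑ (suc j) _) ⟩
  ℤ[[β]].∑ (suc i) (λ a → (f a ℤ[[β]].⊛ g (i ∸ a)) j)
    ≡⟨ coeff-∑ (suc i) _ j ⟨
  (f ℤ[[β]][[α]].⊛ g) i j ∎
  where open ≡.≡-Reasoning

1ₚ≋𝟙 : 1ₚ ℤ[[β]][[α]].≋ ℤ[[β]][[α]].𝟙
1ₚ≋𝟙 zero    zero    = ≡.refl
1ₚ≋𝟙 zero    (suc j) = ≡.refl
1ₚ≋𝟙 (suc i) j       = ≡.refl

infix 4 _≈ₚ_
record _≈ₚ_ (f g : PS) : Set where
  constructor coeffwise
  field coeff-≡ : ∀ i j → f i j ≡ g i j
open _≈ₚ_ public

PS-rawRing : RawRing _ _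
PS-rawRing = record
  { Carrier = PS ; _≈_ = _≈ₚ_
  ; _+_ = _+ₚ_ ; _*_ = _*ₚ_ ; -_ = -ₚ_ ; 0# = 0ₚ ; 1# = 1ₚ }

-- PS is ℤ[[β]][[α]], with the product written as a double Cauchy sum.
PS↪ℤ[[β]][[α]] : IsRingMonomorphism PS-rawRing (CommutativeRing.rawRing ℤ[[β]][[α]].commutativeRing) id
PS↪ℤ[[β]][[α]] = record
  { isRingHomomorphism = record
    { isSemiringHomomorphism = record
      { isNearSemiringHomomorphism = record
        { +-isMonoidHomomorphism = record
          { isMagmaHomomorphism = record
            { isRelHomomorphism = record { cong = coeff-≡ }
            ; homo = λ _ _ _ _ → ≡.refl }
          ; ε-homo = λ _ _ → ≡.refl }
        ; *-homo = *ₚ≋⊛ }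
      ; 1#-homo = 1ₚ≋𝟙 }
    ; -‿homo = λ _ _ _ → ≡.refl }
  ; injective = coeffwise }

ℤ[[α,β]] : CommutativeRing _ _
ℤ[[α,β]] = record
  { isCommutativeRing = RingMonomorphism.isCommutativeRing PS↪ℤ[[β]][[α]]
                          (CommutativeRing.isCommutativeRing ℤ[[β]][[α]].commutativeRing) }

constₚ≋const : ∀ a → constₚ a ℤ[[β]][[α]].≋ ℤ[[β]][[α]].const (ℤ[[β]].const a)
constₚ≋const a zero    zero    = ≡.refl
constₚ≋const a zero    (suc j) = ≡.refl
constₚ≋const a (suc i) j       = ≡.refl

constₚ-*ₚ-coeff : ∀ a f i j → (constₚ a *ₚ f) i j ≡ a *ℤ f i j
constₚ-*ₚ-coeff a f i j = begin
  (constₚ a *ₚ f) i j                                      ≡⟨ *ₚ≋⊛ (constₚ a) f i j ⟩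
  (constₚ a ℤ[[β]][[α]].⊛ f) i j                              ≡⟨ ℤ[[β]][[α]].⊛-cong {g = f} {f} (constₚ≋const a) (λ _ _ → ≡.refl) i j ⟩
  (ℤ[[β]][[α]].const (ℤ[[β]].const a) ℤ[[β]][[α]].⊛ f) i j       ≡⟨ ℤ[[β]][[α]].const-⊛ (ℤ[[β]].const a) f i j ⟩
  (ℤ[[β]].const a ℤ[[β]].⊛ f i) j                          ≡⟨ ℤ[[β]].const-⊛ a (f i) j ⟩
  a *ℤ f i j                                               ∎
  where open ≡.≡-Reasoning

constₚ-+ : ∀ a b → constₚ (a +ℤ b) ≈ₚ constₚ a +ₚ constₚ b
constₚ-+ a b = coeffwise λ { zero zero → ≡.refl ; zero (suc j) → ≡.refl ; (suc i) j → ≡.refl }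

constₚ-* : ∀ a b → constₚ (a *ℤ b) ≈ₚ constₚ a *ₚ constₚ b
constₚ-* a b = coeffwise λ i j → ≡.trans (scale i j) (≡.sym (constₚ-*ₚ-coeff a (constₚ b) i j))
  where
  scale : ∀ i j → constₚ (a *ℤ b) i j ≡ a *ℤ constₚ b i j
  scale zero    zero    = ≡.refl
  scale zero    (suc j) = ≡.sym (ℤ.*-zeroʳ a)
  scale (suc i) j       = ≡.sym (ℤ.*-zeroʳ a)

constₚ-neg : ∀ a → constₚ (-ℤ a) ≈ₚ -ₚ constₚ a
constₚ-neg a = coeffwise λ { zero zero → ≡.refl ; zero (suc j) → ≡.refl ; (suc i) j → ≡.refl }

constₚ-0 : constₚ 0ℤ ≈ₚ 0ₚ
constₚ-0 = coeffwise λ { zero zero → ≡.refl ; zero (suc j) → ≡.refl ; (suc i) j → ≡.refl }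

PS-almostCommutativeRing : ACR.AlmostCommutativeRing _ _
PS-almostCommutativeRing = ACR.fromCommutativeRing ℤ[[α,β]]

constₚ-homomorphism : CommutativeRing.rawRing ℤ.+-*-commutativeRing ACR.-Raw-AlmostCommutative⟶ PS-almostCommutativeRing
constₚ-homomorphism = record
  { ⟦_⟧ = constₚ ; +-homo = constₚ-+ ; *-homo = constₚ-* ; -‿homo = constₚ-neg
  ; 0-homo = constₚ-0 ; 1-homo = coeffwise λ _ _ → ≡.refl }

constₚ-≈? : ∀ a b → Maybe (constₚ a ≈ₚ constₚ b)
constₚ-≈? a b with a ≟ℤ b
... | yes ≡.refl = just (coeffwise λ _ _ → ≡.refl)
... | no  _      = nothing

-- Integer coefficients let the solver decide when constants cancel.
open import Algebra.Solver.Ring (CommutativeRing.rawRing ℤ.+-*-commutativeRing) PS-almostCommutativeRing constₚ-homomorphism constₚ-≈?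
  using (solve; _:=_; Polynomial; con; _:+_; _:*_; :-_)

open CommutativeRing ℤ[[α,β]]
  using ( refl; sym; trans; reflexive; setoid; semiring; +-cong; +-congˡ; +-congʳ; *-cong; *-congˡ; *-congʳ; -‿cong
        ; +-comm; +-assoc; *-assoc; +-identityˡ; +-identityʳ; *-identityˡ; *-identityʳ; zeroˡ; zeroʳ; distribˡ )
open import Algebra.Properties.Semiring.Exp semiring using (_^_; ^-congˡ; ^-homo-*)
open import Algebra.Properties.Semiring.Mult semiring using (×-assoc-*; ×-congʳ) renaming (_×_ to _×ₙ_)
open import Algebra.Properties.Semiring.Sum semiring using (sum⁺-syntax; sum-syntax; sum-cong-≋)
open import Algebra.Properties.CommutativeSemigroup (CommutativeRing.*-commutativeSemigroup ℤ[[α,β]]) using (x∙yz≈y∙xz)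
open AlternatingBinomial ℤ[[α,β]] using (∑-alternating-binomial)
module *-Solver = CommutativeMonoidSolver (CommutativeRing.*-commutativeMonoid ℤ[[α,β]])
open import Relation.Binary.Reasoning.Setoid setoid

αₚ≋X : αₚ ℤ[[β]][[α]].≋ ℤ[[β]][[α]].X
αₚ≋X zero          zero    = ≡.refl
αₚ≋X zero          (suc j) = ≡.refl
αₚ≋X (suc zero)    zero    = ≡.refl
αₚ≋X (suc zero)    (suc j) = ≡.refl
αₚ≋X (suc (suc i)) j       = ≡.refl

βₚ≋constX : βₚ ℤ[[β]][[α]].≋ ℤ[[β]][[α]].const ℤ[[β]].X
βₚ≋constX zero    zero          = ≡.refl
βₚ≋constX zero    (suc zero)    = ≡.refl
βₚ≋constX zero    (suc (suc j)) = ≡.refl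
βₚ≋constX (suc i) j             = ≡.refl

αₚ*ₚ-coeff-zero : ∀ f j → (αₚ *ₚ f) 0 j ≡ 0ℤ
αₚ*ₚ-coeff-zero f j = ≡.trans (*ₚ≋⊛ αₚ f 0 j)
  (≡.trans (ℤ[[β]][[α]].⊛-cong {g = f} {f} αₚ≋X (λ _ _ → ≡.refl) 0 j) (ℤ[[β]][[α]].X⊛-zero f j))

αₚ*ₚ-coeff-suc : ∀ f i j → (αₚ *ₚ f) (suc i) j ≡ f i j
αₚ*ₚ-coeff-suc f i j = ≡.trans (*ₚ≋⊛ αₚ f (suc i) j)
  (≡.trans (ℤ[[β]][[α]].⊛-cong {g = f} {f} αₚ≋X (λ _ _ → ≡.refl) (suc i) j) (ℤ[[β]][[α]].X⊛-suc f i j))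

βₚ*ₚ-coeff : ∀ f i j → (βₚ *ₚ f) i j ≡ (ℤ[[β]].X ℤ[[β]].⊛ f i) j
βₚ*ₚ-coeff f i j = ≡.trans (*ₚ≋⊛ βₚ f i j)
  (≡.trans (ℤ[[β]][[α]].⊛-cong {g = f} {f} βₚ≋constX (λ _ _ → ≡.refl) i j) (ℤ[[β]][[α]].const-⊛ ℤ[[β]].X f i j))

βₚ*ₚ-coeff-zero : ∀ f i → (βₚ *ₚ f) i 0 ≡ 0ℤ
βₚ*ₚ-coeff-zero f i = ≡.trans (βₚ*ₚ-coeff f i 0) (ℤ[[β]].X⊛-zero (f i))

βₚ*ₚ-coeff-suc : ∀ f i j → (βₚ *ₚ f) i (suc j) ≡ f i j
βₚ*ₚ-coeff-suc f i j = ≡.trans (βₚ*ₚ-coeff f i (suc j)) (ℤ[[β]].X⊛-suc (f i) j)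

inv1-α-unfold : inv1-α ≈ₚ 1ₚ +ₚ αₚ *ₚ inv1-α
inv1-α-unfold = coeffwise λ
  { zero    zero    → ≡.cong (1ℤ +ℤ_) (≡.sym (αₚ*ₚ-coeff-zero inv1-α 0))
  ; zero    (suc j) → ≡.cong (0ℤ +ℤ_) (≡.sym (αₚ*ₚ-coeff-zero inv1-α (suc j)))
  ; (suc i) zero    → ≡.cong (0ℤ +ℤ_) (≡.sym (αₚ*ₚ-coeff-suc inv1-α i 0))
  ; (suc i) (suc j) → ≡.cong (0ℤ +ℤ_) (≡.sym (αₚ*ₚ-coeff-suc inv1-α i (suc j))) }

inv1-β-unfold : inv1-β ≈ₚ 1ₚ +ₚ βₚ *ₚ inv1-β
inv1-β-unfold = coeffwise λ
  { zero    zero    → ≡.cong (1ℤ +ℤ_) (≡.sym (βₚ*ₚ-coeff-zero inv1-β 0))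
  ; (suc i) zero    → ≡.cong (0ℤ +ℤ_) (≡.sym (βₚ*ₚ-coeff-zero inv1-β (suc i)))
  ; zero    (suc j) → ≡.cong (0ℤ +ℤ_) (≡.sym (βₚ*ₚ-coeff-suc inv1-β 0 j))
  ; (suc i) (suc j) → ≡.cong (0ℤ +ℤ_) (≡.sym (βₚ*ₚ-coeff-suc inv1-β (suc i) j)) }

-- Normal forms of A₁^k and A₀^ℓ

𝔭 𝔮 : PS
𝔭 = βₚ *ₚ inv1-α
𝔮 = αₚ *ₚ inv1-β

𝔭-unfold : 𝔭 ≈ₚ βₚ +ₚ αₚ *ₚ 𝔭
𝔭-unfold = trans (*-congˡ {βₚ} inv1-α-unfold)
  (solve 3 (λ b a I → b :* (con 1ℤ :+ a :* I) := b :+ a :* (b :* I)) refl βₚ αₚ inv1-α)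

𝔮-unfold : 𝔮 ≈ₚ αₚ +ₚ βₚ *ₚ 𝔮
𝔮-unfold = trans (*-congˡ {αₚ} inv1-β-unfold)
  (solve 3 (λ a b I → a :* (con 1ℤ :+ b :* I) := a :+ b :* (a :* I)) refl αₚ βₚ inv1-β)

infix 4 _≈ₘ_
record _≈ₘ_ (A B : M2) : Set where
  constructor entrywise
  field
    m00-≈ : m00 A ≈ₚ m00 B
    m01-≈ : m01 A ≈ₚ m01 B
    m10-≈ : m10 A ≈ₚ m10 B
    m11-≈ : m11 A ≈ₚ m11 B
open _≈ₘ_ public

≈ₘ-refl : ∀ {A} → A ≈ₘ A
≈ₘ-refl = entrywise refl refl refl refl

≈ₘ-trans : ∀ {A B C} → A ≈ₘ B → B ≈ₘ C → A ≈ₘ C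
≈ₘ-trans (entrywise a b c d) (entrywise a′ b′ c′ d′) = entrywise (trans a a′) (trans b b′) (trans c c′) (trans d d′)

*ₘ-cong : ∀ {A A′ B B′} → A ≈ₘ A′ → B ≈ₘ B′ → A *ₘ B ≈ₘ A′ *ₘ B′
*ₘ-cong (entrywise a b c d) (entrywise a′ b′ c′ d′) = entrywise
  (+-cong (*-cong a a′) (*-cong b c′)) (+-cong (*-cong a b′) (*-cong b d′))
  (+-cong (*-cong c a′) (*-cong d c′)) (+-cong (*-cong c b′) (*-cong d d′))

-- The zero entries are written constₚ 0ℤ, the form in which the ring solver produces zero.
upper lower : PS → PS → M2
upper p x = mat x (p *ₚ (1ₚ +ₚ -ₚ x)) (constₚ 0ℤ) 1ₚ
lower q y = mat 1ₚ (constₚ 0ℤ) (q *ₚ (1ₚ +ₚ -ₚ y)) y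

1-0≈1 : 1ₚ +ₚ -ₚ 0ₚ ≈ₚ 1ₚ
1-0≈1 = coeffwise λ { zero zero → ≡.refl ; zero (suc j) → ≡.refl ; (suc i) j → ≡.refl }

0*y+1*z≈z : ∀ y z → 0ₚ *ₚ y +ₚ 1ₚ *ₚ z ≈ₚ z
0*y+1*z≈z y z = trans (+-cong (zeroˡ y) (*-identityˡ z)) (+-identityˡ z)

1*z+0*w≈z : ∀ z w → 1ₚ *ₚ z +ₚ 0ₚ *ₚ w ≈ₚ z
1*z+0*w≈z z w = trans (+-cong (*-identityˡ z) (zeroˡ w)) (+-identityʳ z)

geometric-step : ∀ r s t z → r ≈ₚ s +ₚ t *ₚ r → t *ₚ (r *ₚ (1ₚ +ₚ -ₚ z)) +ₚ s *ₚ 1ₚ ≈ₚ r *ₚ (1ₚ +ₚ -ₚ (t *ₚ z))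
geometric-step r s t z r≈s+tr = trans
  (solve 4 (λ r s t z → t :* (r :* (con 1ℤ :+ :- z)) :+ s :* con 1ℤ := (s :+ t :* r) :+ :- (t :* r :* z)) refl r s t z)
  (trans (+-congʳ { -ₚ (t *ₚ r *ₚ z)} (sym r≈s+tr))
  (solve 3 (λ r t z → r :+ :- (t :* r :* z) := r :* (con 1ℤ :+ :- (t :* z))) refl r t z))

upper-^ₘ : ∀ {a b p} → p ≈ₚ b +ₚ a *ₚ p → ∀ n → mat a b 0ₚ 1ₚ ^ₘ n ≈ₘ upper p (a ^ₚ n)
upper-^ₘ {a} {b} {p} p≈b+ap zero =
  entrywise refl (trans (sym constₚ-0) (solve 1 (λ p → con 0ℤ := p :* (con 1ℤ :+ :- con 1ℤ)) refl p)) (sym constₚ-0) refl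
upper-^ₘ {a} {b} {p} p≈b+ap (suc n) = ≈ₘ-trans (*ₘ-cong (≈ₘ-refl {mat a b 0ₚ 1ₚ}) (upper-^ₘ p≈b+ap n))
  (entrywise (solve 3 (λ a b x → a :* x :+ b :* con 0ℤ := a :* x) refl a b x)
             (geometric-step p b a x p≈b+ap)
             (0*y+1*z≈z x (constₚ 0ℤ))
             (0*y+1*z≈z (p *ₚ (1ₚ +ₚ -ₚ x)) 1ₚ))
  where x = a ^ₚ n

lower-^ₘ : ∀ {a b q} → q ≈ₚ a +ₚ b *ₚ q → ∀ n → mat 1ₚ 0ₚ a b ^ₘ n ≈ₘ lower q (b ^ₚ n)
lower-^ₘ {a} {b} {q} q≈a+bq zero =
  entrywise refl (sym constₚ-0) (trans (sym constₚ-0) (solve 1 (λ q → con 0ℤ := q :* (con 1ℤ :+ :- con 1ℤ)) refl q)) refl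
lower-^ₘ {a} {b} {q} q≈a+bq (suc n) = ≈ₘ-trans (*ₘ-cong (≈ₘ-refl {mat 1ₚ 0ₚ a b}) (lower-^ₘ q≈a+bq n))
  (entrywise (1*z+0*w≈z 1ₚ (q *ₚ (1ₚ +ₚ -ₚ y)))
             (1*z+0*w≈z (constₚ 0ℤ) y)
             (trans (+-comm (a *ₚ 1ₚ) (b *ₚ (q *ₚ (1ₚ +ₚ -ₚ y)))) (geometric-step q a b y q≈a+bq))
             (solve 3 (λ a b y → a :* con 0ℤ :+ b :* y := b :* y) refl a b y))
  where y = b ^ₚ n

A₁^-upper : ∀ k → A₁^ k ≈ₘ upper 𝔭 (αₚ ^∞ k)
A₁^-upper (fin n) = upper-^ₘ 𝔭-unfold n
A₁^-upper ∞       = entrywise refl (sym (trans (*-congˡ {𝔭} 1-0≈1) (*-identityʳ 𝔭))) (sym constₚ-0) refl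

A₀^-lower : ∀ ℓ → A₀^ ℓ ≈ₘ lower 𝔮 (βₚ ^∞ ℓ)
A₀^-lower (fin n) = lower-^ₘ 𝔮-unfold n
A₀^-lower ∞       = entrywise refl (sym constₚ-0) (sym (trans (*-congˡ {𝔮} 1-0≈1) (*-identityʳ 𝔮))) refl

-- The weight of a binary word

𝔠 𝔡 : PS
𝔠 = 𝔭 *ₚ 𝔮
𝔡 = -ₚ 1ₚ +ₚ 𝔠

open PairExpansion PS-rawRing public

weight : Bool → List Bool → PS
weight b (s ∷ t ∷ τ) = pairWeight 𝔠 b s t *ₚ weight t τ
weight _ _           = 1ₚ

closedWeight : ℕ → ℕ → PS
closedWeight n m = 𝔠 ^ (n ∸ m) *ₚ 𝔡 ^ m

closedWeight-𝔠 : ∀ m n {W} → m ≤ n → W ≈ₚ closedWeight n m → 𝔠 *ₚ W ≈ₚ closedWeight (suc n) m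
closedWeight-𝔠 m n {W} m≤n W≈ = begin
  𝔠 *ₚ W                           ≈⟨ *-congˡ {𝔠} W≈ ⟩
  𝔠 *ₚ (𝔠 ^ (n ∸ m) *ₚ 𝔡 ^ m)      ≈⟨ *-assoc 𝔠 (𝔠 ^ (n ∸ m)) (𝔡 ^ m) ⟨
  𝔠 ^ suc (n ∸ m) *ₚ 𝔡 ^ m         ≡⟨ ≡.cong (λ e → 𝔠 ^ e *ₚ 𝔡 ^ m) (+-∸-assoc 1 m≤n) ⟨
  𝔠 ^ (suc n ∸ m) *ₚ 𝔡 ^ m         ∎

closedWeight-𝔡 : ∀ m n {W} → W ≈ₚ closedWeight n m → 𝔡 *ₚ W ≈ₚ closedWeight (suc n) (suc m)
closedWeight-𝔡 m n W≈ = trans (*-congˡ {𝔡} W≈) (x∙yz≈y∙xz 𝔡 (𝔠 ^ (n ∸ m)) (𝔡 ^ m))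

weight-step : ∀ b s t {n τ} → count10 (t ∷ τ) ≤ n → weight t τ ≈ₚ closedWeight n (count10 (t ∷ τ)) →
  count10 (b ∷ s ∷ t ∷ τ) ≤ suc n × weight b (s ∷ t ∷ τ) ≈ₚ closedWeight (suc n) (count10 (b ∷ s ∷ t ∷ τ))
weight-step false false t     {n}     m≤n W≈ = ≤-trans m≤n (n≤1+n n) , closedWeight-𝔠 _ n m≤n W≈
weight-step false true  false {n} {τ} m≤n W≈ = s≤s m≤n , closedWeight-𝔡 (count10 (false ∷ τ)) n W≈
weight-step false true  true  {n}     m≤n W≈ = ≤-trans m≤n (n≤1+n n) , closedWeight-𝔠 _ n m≤n W≈
weight-step true  false t     {n} {τ} m≤n W≈ = s≤s m≤n , closedWeight-𝔡 (count10 (t ∷ τ)) n W≈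
weight-step true  true  false {n} {τ} m≤n W≈ = s≤s m≤n , closedWeight-𝔡 (count10 (false ∷ τ)) n W≈
weight-step true  true  true  {n}     m≤n W≈ = ≤-trans m≤n (n≤1+n n) , closedWeight-𝔠 _ n m≤n W≈

weight-closed : ∀ b {n τ} → Pairs n τ → count10 (b ∷ τ) ≤ n × weight b τ ≈ₚ closedWeight n (count10 (b ∷ τ))
weight-closed false []             = z≤n , sym (*-identityˡ 1ₚ)
weight-closed true  []             = z≤n , sym (*-identityˡ 1ₚ)
weight-closed b     (pair s t τ-pairs) =
  let m≤n , W≈ = weight-closed t τ-pairs in weight-step b s t m≤n W≈

^ₚ≈^ : ∀ f n → f ^ₚ n ≈ₚ f ^ n
^ₚ≈^ f zero    = refl
^ₚ≈^ f (suc n) = *-congˡ {f} (^ₚ≈^ f n)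

𝔟≈𝔠^ : ∀ n → 𝔟 n ≈ₚ 𝔠 ^ n
𝔟≈𝔠^ n = trans (^ₚ≈^ _ n) (^-congˡ n
  (solve 4 (λ a b I J → a :* b :* I :* J := (b :* I) :* (a :* J)) refl αₚ βₚ inv1-α inv1-β))

constₚ-pos : ∀ n → constₚ (+ n) ≈ₚ n ×ₙ 1ₚ
constₚ-pos zero    = constₚ-0
constₚ-pos (suc n) = trans (constₚ-+ (+ 1) (+ n)) (+-congˡ {1ₚ} (constₚ-pos n))

constₚ-sign : ∀ j → constₚ (-1ℤ ^ℤ j) ≈ₚ (-ₚ 1ₚ) ^ j
constₚ-sign zero    = refl
constₚ-sign (suc j) = trans (constₚ-* -1ℤ (-1ℤ ^ℤ j)) (*-cong (constₚ-neg 1ℤ) (constₚ-sign j))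

sumₚ-applyUpTo : ∀ n (f : ℕ → PS) g → sumₚ (map f (applyUpTo g n)) ≡ ∑[ j < n ] f (g (toℕ j))
sumₚ-applyUpTo zero    f g = ≡.refl
sumₚ-applyUpTo (suc n) f g = ≡.cong (f (g 0) +ₚ_) (sumₚ-applyUpTo n f (λ j → g (suc j)))

constₚ-pos-*ₚ : ∀ n s f → constₚ (+ n *ℤ s) *ₚ f ≈ₚ n ×ₙ (constₚ s *ₚ f)
constₚ-pos-*ₚ n s f = begin
  constₚ (+ n *ℤ s) *ₚ f              ≈⟨ *-congʳ {f} (constₚ-* (+ n) s) ⟩
  constₚ (+ n) *ₚ constₚ s *ₚ f       ≈⟨ *-assoc (constₚ (+ n)) (constₚ s) f ⟩
  constₚ (+ n) *ₚ (constₚ s *ₚ f)     ≈⟨ *-congʳ {constₚ s *ₚ f} (constₚ-pos n) ⟩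
  n ×ₙ 1ₚ *ₚ (constₚ s *ₚ f)          ≈⟨ ×-assoc-* n 1ₚ (constₚ s *ₚ f) ⟩
  n ×ₙ (1ₚ *ₚ (constₚ s *ₚ f))        ≈⟨ ×-congʳ n (*-identityˡ (constₚ s *ₚ f)) ⟩
  n ×ₙ (constₚ s *ₚ f)                ∎

alternating-𝔟-sum : ∀ {m N} → m ≤ N →
  Σ≤ₚ m (λ j → constₚ (+ (m C j) *ℤ (-1ℤ ^ℤ j)) *ₚ 𝔟 (N ∸ j)) ≈ₚ closedWeight N m
alternating-𝔟-sum {m} {N} m≤N = begin
  Σ≤ₚ m (λ j → constₚ (+ (m C j) *ℤ (-1ℤ ^ℤ j)) *ₚ 𝔟 (N ∸ j))
    ≡⟨ sumₚ-applyUpTo (suc m) (λ j → constₚ (+ (m C j) *ℤ (-1ℤ ^ℤ j)) *ₚ 𝔟 (N ∸ j)) (λ j → j) ⟩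
  ∑[ j ≤ m ] (constₚ (+ (m C toℕ j) *ℤ (-1ℤ ^ℤ toℕ j)) *ₚ 𝔟 (N ∸ toℕ j))
    ≈⟨ sum-cong-≋ {suc m} (λ j → trans (constₚ-pos-*ₚ (m C toℕ j) (-1ℤ ^ℤ toℕ j) (𝔟 (N ∸ toℕ j)))
                                       (×-congʳ (m C toℕ j) (*-cong (constₚ-sign (toℕ j)) (𝔟≈𝔠^ (N ∸ toℕ j))))) ⟩
  ∑[ j ≤ m ] ((m C toℕ j) ×ₙ ((-ₚ 1ₚ) ^ toℕ j *ₚ 𝔠 ^ (N ∸ toℕ j)))
    ≈⟨ ∑-alternating-binomial m≤N 𝔠 ⟩
  𝔠 ^ (N ∸ m) *ₚ 𝔡 ^ m
    ∎

alternating-𝔟-sum≈weight : ∀ {N τ} → Pairs N τ →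
  Σ≤ₚ (count10 τ) (λ j → constₚ (+ (count10 τ C j) *ℤ (-1ℤ ^ℤ j)) *ₚ 𝔟 (N ∸ j)) ≈ₚ weight false τ
alternating-𝔟-sum≈weight τ-pairs =
  let m≤N , w≈ = weight-closed false τ-pairs in trans (alternating-𝔟-sum m≤N) (sym w≈)

-- Expansion of γ_t over binary words

sumₚ-++ : ∀ xs ys → sumₚ (xs ++ ys) ≈ₚ sumₚ xs +ₚ sumₚ ys
sumₚ-++ []       ys = sym (+-identityˡ (sumₚ ys))
sumₚ-++ (x ∷ xs) ys = trans (+-congˡ {x} (sumₚ-++ xs ys)) (sym (+-assoc x (sumₚ xs) (sumₚ ys)))

sumₚ-cong : ∀ {A : Set} {f g : A → PS} xs → (∀ x → f x ≈ₚ g x) → sumₚ (map f xs) ≈ₚ sumₚ (map g xs)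
sumₚ-cong []       f≈g = refl
sumₚ-cong (x ∷ xs) f≈g = +-cong (f≈g x) (sumₚ-cong xs f≈g)

*-distribˡ-sumₚ : ∀ {A : Set} a (f : A → PS) xs → a *ₚ sumₚ (map f xs) ≈ₚ sumₚ (map (λ x → a *ₚ f x) xs)
*-distribˡ-sumₚ a f []       = zeroʳ a
*-distribˡ-sumₚ a f (x ∷ xs) = trans (distribˡ a (f x) (sumₚ (map f xs))) (+-congˡ {a *ₚ f x} (*-distribˡ-sumₚ a f xs))

sumₚ-allWords-suc : ∀ n (f : Vec Bool (suc n) → PS) →
  sumₚ (map f (allWords (suc n))) ≈ₚ sumₚ (map (λ τ → f (false ∷ᵥ τ)) (allWords n)) +ₚ sumₚ (map (λ τ → f (true ∷ᵥ τ)) (allWords n))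
sumₚ-allWords-suc n f = begin
  sumₚ (map f (map (false ∷ᵥ_) (allWords n) ++ map (true ∷ᵥ_) (allWords n)))
    ≡⟨ ≡.cong sumₚ (List.map-++ f (map (false ∷ᵥ_) (allWords n)) _) ⟩
  sumₚ (map f (map (false ∷ᵥ_) (allWords n)) ++ map f (map (true ∷ᵥ_) (allWords n)))
    ≈⟨ sumₚ-++ (map f (map (false ∷ᵥ_) (allWords n))) _ ⟩
  sumₚ (map f (map (false ∷ᵥ_) (allWords n))) +ₚ sumₚ (map f (map (true ∷ᵥ_) (allWords n)))
    ≡⟨ ≡.cong₂ (λ xs ys → sumₚ xs +ₚ sumₚ ys) (List.map-∘ (allWords n)) (List.map-∘ (allWords n)) ⟨
  sumₚ (map (λ τ → f (false ∷ᵥ τ)) (allWords n)) +ₚ sumₚ (map (λ τ → f (true ∷ᵥ τ)) (allWords n))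
    ∎

sign-count1 : ∀ s τ → constₚ (-1ℤ ^ℤ count1 (s ∷ τ)) ≈ₚ sign s *ₚ constₚ (-1ℤ ^ℤ count1 τ)
sign-count1 false τ = sym (*-identityˡ _)
sign-count1 true  τ = trans (constₚ-* -1ℤ _) (*-congʳ {constₚ (-1ℤ ^ℤ count1 τ)} (constₚ-neg 1ℤ))

^∞-+∞ : ∀ X a b → X ^∞ (a +∞ b) ≈ₚ X ^∞ a *ₚ X ^∞ b
^∞-+∞ X (fin m) (fin n) = trans (^ₚ≈^ X (m +ℕ n)) (trans (^-homo-* X m n) (sym (*-cong (^ₚ≈^ X m) (^ₚ≈^ X n))))
^∞-+∞ X (fin m) ∞       = sym (zeroʳ (X ^ₚ m))
^∞-+∞ X ∞       b       = sym (zeroˡ (X ^∞ b))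

^∞-dot-∷ : ∀ X s k τ u → X ^∞ dot (s ∷ τ) (k ∷ u) ≈ₚ pick s (X ^∞ k) *ₚ X ^∞ dot τ u
^∞-dot-∷ X false k τ u = ^∞-+∞ X (fin 0) (dot τ u)
^∞-dot-∷ X true  k τ u = ^∞-+∞ X k (dot τ u)

^∞-dot-fin0 : ∀ X s τ u → X ^∞ dot (s ∷ τ) (fin 0 ∷ u) ≡ X ^∞ dot τ u
^∞-dot-fin0 X s τ u with s | dot τ u
... | false | fin n = ≡.refl
... | false | ∞     = ≡.refl
... | true  | fin n = ≡.refl
... | true  | ∞     = ≡.refl

signedMonomial : List ℕ∞ → List Bool → PS
signedMonomial u τ = constₚ (-1ℤ ^ℤ count1 τ) *ₚ (αₚ ^∞ dot τ (evenPart u)) *ₚ (βₚ ^∞ dot τ (oddPart u))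

summand : Bool → List ℕ∞ → List Bool → PS
summand b u τ = signedMonomial u τ *ₚ weight b τ

summand-∷∷ : ∀ b k ℓ r s t τ →
  summand b (k ∷ ℓ ∷ r) (s ∷ t ∷ τ) ≈ₚ pairCoefficient 𝔠 (αₚ ^∞ k) (βₚ ^∞ ℓ) b s t *ₚ summand t r τ
summand-∷∷ b k ℓ r s t τ = begin
  summand b (k ∷ ℓ ∷ r) (s ∷ t ∷ τ)
    ≈⟨ *-congʳ {w *ₚ W} (*-cong (*-cong (trans (sign-count1 s (t ∷ τ)) (*-congˡ {sign s} (sign-count1 t τ))) α-part) β-part) ⟩
  sign s *ₚ (sign t *ₚ S) *ₚ (pick s x *ₚ A) *ₚ (pick t y *ₚ B) *ₚ (w *ₚ W)
    ≈⟨ *-Solver.prove 9 ((((v₀ ⊕ (v₁ ⊕ v₂)) ⊕ (v₃ ⊕ v₄)) ⊕ (v₅ ⊕ v₆)) ⊕ (v₇ ⊕ v₈))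
                        ((((v₀ ⊕ v₃) ⊕ (v₁ ⊕ v₅)) ⊕ v₇) ⊕ (((v₂ ⊕ v₄) ⊕ v₆) ⊕ v₈))
                        (sign s ∷ᵥ sign t ∷ᵥ S ∷ᵥ pick s x ∷ᵥ A ∷ᵥ pick t y ∷ᵥ B ∷ᵥ w ∷ᵥ W ∷ᵥ []ᵥ) ⟩
  pairCoefficient 𝔠 x y b s t *ₚ summand t r τ
    ∎
  where
  open *-Solver using (_⊕_; var)
  v₀ = var 0F; v₁ = var 1F; v₂ = var 2F; v₃ = var 3F; v₄ = var 4F; v₅ = var 5F; v₆ = var 6F; v₇ = var 7F; v₈ = var 8F
  x = αₚ ^∞ k
  y = βₚ ^∞ ℓ
  S = constₚ (-1ℤ ^ℤ count1 τ)
  A = αₚ ^∞ dot τ (evenPart r)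
  B = βₚ ^∞ dot τ (oddPart r)
  w = pairWeight 𝔠 b s t
  W = weight t τ
  α-part : αₚ ^∞ dot (s ∷ t ∷ τ) (k ∷ fin 0 ∷ evenPart r) ≈ₚ pick s x *ₚ A
  α-part = trans (^∞-dot-∷ αₚ s k (t ∷ τ) _) (*-congˡ {pick s x} (reflexive (^∞-dot-fin0 αₚ t τ (evenPart r))))
  β-part : βₚ ^∞ dot (s ∷ t ∷ τ) (fin 0 ∷ ℓ ∷ oddPart r) ≈ₚ pick t y *ₚ B
  β-part = trans (reflexive (^∞-dot-fin0 βₚ s (t ∷ τ) (ℓ ∷ oddPart r))) (^∞-dot-∷ βₚ t ℓ τ (oddPart r))

wordSum : Bool → List ℕ∞ → PS
wordSum b u = sumₚ (map (λ τ → summand b u (toList τ)) (allWords (length u)))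

wordSum-∷∷ : ∀ b k ℓ r →
  wordSum b (k ∷ ℓ ∷ r) ≈ₚ pairSum 𝔠 (αₚ ^∞ k) (βₚ ^∞ ℓ) (wordSum false r) (wordSum true r) b
wordSum-∷∷ b k ℓ r = begin
  wordSum b (k ∷ ℓ ∷ r)
    ≈⟨ sumₚ-allWords-suc (suc (length r)) _ ⟩
  sumₚ (map (λ τ → F (false ∷ᵥ τ)) (allWords (suc (length r)))) +ₚ sumₚ (map (λ τ → F (true ∷ᵥ τ)) (allWords (suc (length r))))
    ≈⟨ +-cong (sumₚ-allWords-suc (length r) _) (sumₚ-allWords-suc (length r) _) ⟩
  (quarter false false +ₚ quarter false true) +ₚ (quarter true false +ₚ quarter true true)
    ≈⟨ +-cong (+-cong (quarter≈ false false) (quarter≈ false true)) (+-cong (quarter≈ true false) (quarter≈ true true)) ⟩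
  pairSum 𝔠 x y (wordSum false r) (wordSum true r) b
    ∎
  where
  x = αₚ ^∞ k
  y = βₚ ^∞ ℓ
  F : Vec Bool (suc (suc (length r))) → PS
  F τ = summand b (k ∷ ℓ ∷ r) (toList τ)
  quarter : Bool → Bool → PS
  quarter s t = sumₚ (map (λ τ → F (s ∷ᵥ t ∷ᵥ τ)) (allWords (length r)))
  quarter≈ : ∀ s t → quarter s t ≈ₚ pairCoefficient 𝔠 x y b s t *ₚ wordSum t r
  quarter≈ s t = trans (sumₚ-cong (allWords (length r)) (λ τ → summand-∷∷ b k ℓ r s t (toList τ)))
                       (sym (*-distribˡ-sumₚ (pairCoefficient 𝔠 x y b s t) _ (allWords (length r))))

polynomialRawRing : ℕ → RawRing _ _
polynomialRawRing n = record
  { Carrier = Polynomial n ; _≈_ = _≡_ ; _+_ = _:+_ ; _*_ = _:*_ ; -_ = :-_ ; 0# = con 0ℤ ; 1# = con 1ℤ }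

module PairExpansionᴾ {n} = PairExpansion (polynomialRawRing n)

column-top : ∀ x y G₀ G₁ z w →
  m00 (upper 𝔭 x *ₘ (lower 𝔮 y *ₘ mat G₀ z (𝔮 *ₚ (G₀ +ₚ -ₚ G₁)) w)) ≈ₚ pairSum 𝔠 x y G₀ G₁ false
column-top x y G₀ G₁ _ _ = solve 6
  (λ p q x y G₀ G₁ →
     x :* (con 1ℤ :* G₀ :+ con 0ℤ :* (q :* (G₀ :+ :- G₁))) :+
     (p :* (con 1ℤ :+ :- x)) :* ((q :* (con 1ℤ :+ :- y)) :* G₀ :+ y :* (q :* (G₀ :+ :- G₁)))
     := PairExpansionᴾ.pairSum (p :* q) x y G₀ G₁ false)
  refl 𝔭 𝔮 x y G₀ G₁

pairSum-difference : ∀ c x y G₀ G₁ →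
  pairSum c x y G₀ G₁ false +ₚ -ₚ pairSum c x y G₀ G₁ true ≈ₚ G₀ +ₚ -ₚ (y *ₚ G₁)
pairSum-difference = solve 5
  (λ c x y G₀ G₁ →
     PairExpansionᴾ.pairSum c x y G₀ G₁ false :+ :- PairExpansionᴾ.pairSum c x y G₀ G₁ true
     := G₀ :+ :- (y :* G₁))
  refl

column-bottom : ∀ x y G₀ G₁ z w →
  m10 (upper 𝔭 x *ₘ (lower 𝔮 y *ₘ mat G₀ z (𝔮 *ₚ (G₀ +ₚ -ₚ G₁)) w)) ≈ₚ 𝔮 *ₚ (G₀ +ₚ -ₚ (y *ₚ G₁))
column-bottom x y G₀ G₁ _ _ = solve 4
  (λ q y G₀ G₁ →
     con 0ℤ :* (con 1ℤ :* G₀ :+ con 0ℤ :* (q :* (G₀ :+ :- G₁))) :+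
     con 1ℤ :* ((q :* (con 1ℤ :+ :- y)) :* G₀ :+ y :* (q :* (G₀ :+ :- G₁)))
     := q :* (G₀ :+ :- (y :* G₁)))
  refl 𝔮 y G₀ G₁

firstColumn : ∀ {n u} → Pairs n u →
  m00 (prodMat u) ≈ₚ wordSum false u × m10 (prodMat u) ≈ₚ 𝔮 *ₚ (wordSum false u +ₚ -ₚ wordSum true u)
firstColumn [] =
  sym (trans (+-identityʳ (summand false [] [])) (solve 0 (con 1ℤ :* con 1ℤ :* con 1ℤ :* con 1ℤ := con 1ℤ) refl)) ,
  trans (sym constₚ-0) (solve 2 (λ q W → con 0ℤ := q :* (W :+ :- W)) refl 𝔮 (wordSum false []))
firstColumn (pair {xs = r} k ℓ r-pairs) = top , bottom
  where
  column≈ : prodMat r ≈ₘ mat (wordSum false r) (m01 (prodMat r)) (𝔮 *ₚ (wordSum false r +ₚ -ₚ wordSum true r)) (m11 (prodMat r))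
  column≈ = entrywise (proj₁ (firstColumn r-pairs)) refl (proj₂ (firstColumn r-pairs)) refl
  product≈ = *ₘ-cong (A₁^-upper k) (*ₘ-cong (A₀^-lower ℓ) column≈)
  top : m00 (prodMat (k ∷ ℓ ∷ r)) ≈ₚ wordSum false (k ∷ ℓ ∷ r)
  top = begin
    m00 (prodMat (k ∷ ℓ ∷ r))
      ≈⟨ m00-≈ product≈ ⟩
    _ ≈⟨ column-top (αₚ ^∞ k) (βₚ ^∞ ℓ) (wordSum false r) (wordSum true r) (m01 (prodMat r)) (m11 (prodMat r)) ⟩
    pairSum 𝔠 (αₚ ^∞ k) (βₚ ^∞ ℓ) (wordSum false r) (wordSum true r) false
      ≈⟨ wordSum-∷∷ false k ℓ r ⟨
    wordSum false (k ∷ ℓ ∷ r)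
      ∎
  bottom : m10 (prodMat (k ∷ ℓ ∷ r)) ≈ₚ 𝔮 *ₚ (wordSum false (k ∷ ℓ ∷ r) +ₚ -ₚ wordSum true (k ∷ ℓ ∷ r))
  bottom = begin
    m10 (prodMat (k ∷ ℓ ∷ r))
      ≈⟨ m10-≈ product≈ ⟩
    _ ≈⟨ column-bottom (αₚ ^∞ k) (βₚ ^∞ ℓ) (wordSum false r) (wordSum true r) (m01 (prodMat r)) (m11 (prodMat r)) ⟩
    𝔮 *ₚ (wordSum false r +ₚ -ₚ (βₚ ^∞ ℓ *ₚ wordSum true r))
      ≈⟨ *-congˡ {𝔮} (pairSum-difference 𝔠 (αₚ ^∞ k) (βₚ ^∞ ℓ) (wordSum false r) (wordSum true r)) ⟨
    𝔮 *ₚ (pairSum 𝔠 (αₚ ^∞ k) (βₚ ^∞ ℓ) (wordSum false r) (wordSum true r) false +ₚ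
          -ₚ pairSum 𝔠 (αₚ ^∞ k) (βₚ ^∞ ℓ) (wordSum false r) (wordSum true r) true)
      ≈⟨ *-congˡ {𝔮} (+-cong (wordSum-∷∷ false k ℓ r) (-‿cong (wordSum-∷∷ true k ℓ r))) ⟨
    𝔮 *ₚ (wordSum false (k ∷ ℓ ∷ r) +ₚ -ₚ wordSum true (k ∷ ℓ ∷ r))
      ∎

rhs≈γ : ∀ N (t : Vec ℕ∞ (2 * N)) → rhs N t ≈ₚ γ t
rhs≈γ N t = begin
  rhs N t
    ≈⟨ sumₚ-cong (allWords (2 * N)) (λ τ → *-congˡ {signedMonomial u (toList τ)}
                                             (alternating-𝔟-sum≈weight (length⇒Pairs N (toList τ) (length-toList τ)))) ⟩
  sumₚ (map (λ τ → summand false u (toList τ)) (allWords (2 * N)))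
    ≡⟨ ≡.cong (λ n → sumₚ (map (λ (τ : Vec _ n) → summand false u (toList τ)) (allWords n))) (length-toList t) ⟨
  wordSum false u
    ≈⟨ proj₁ (firstColumn (length⇒Pairs N u (length-toList t))) ⟨
  γ t
    ∎
  where u = toList t

proposition3p4 : (N : ℕ) → 1 ≤ N → (t : Vec ℕ∞ (2 * N)) → All Pos t →
                 (i j : ℕ) → γ t i j ≡ rhs N t i j
proposition3p4 N _ t _ = coeff-≡ (sym (rhs≈γ N t))
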